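{- Let $\mathcal V$ be a variety of $\tau$-algebras axiomatised by the equational theory $T$, and let $\mathbf{Cl}(\mathcal V)$ be its clone $\mathcal V$-algebra. Then: (1) $\mathbf{Cl}(\mathcal V)$ is a finite dimensional clone $\tau$-algebra; (2) the congruence lattice of $\mathbf{Cl}(\mathcal V)$ is isomorphic to the lattice $L(T)$ of all equational theories (of type $\tau$) containing $T$; (3) if $w\in F_{\mathcal V}$ has dimension $n>0$ in $\mathbf{Cl}(\mathcal V)$, then there is a $\tau$-term $t(v_1,\dots,v_n)$ (in at most the variables $v_1,\dots,v_n$) belonging to $w$; (4) if $w\in F_{\mathcal V}$ has dimension $0$, then there is a $\tau$-term $t(v_1)\in w$ with $\mathcal V\models t(v_1)=t(v_2)$; (5) $\mathbf{Cl}(\mathcal V)$ is isomorphic to the subalgebra $\{f^\top: f\in\mathrm{Clo}\,\mathbf F_{\mathcal V}\}$ of the full functional clone $\tau$-algebra with value domain $\mathbf F_{\mathcal V}$.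
   Context: $\mathbf F_{\mathcal V}$ is the free algebra of $\mathcal V$ over the countable set of generators $\{v_1,v_2,\dots\}$, whose elements are equivalence classes of $\tau$-terms modulo $\mathcal V$. The clone $\mathcal V$-algebra is $\mathbf{Cl}(\mathcal V)=(\mathbf F_{\mathcal V},q_n^{\mathbf F}\ (n\ge0),\mathsf e_i^{\mathbf F}\ (i\ge1))$ with $\mathsf e_i^{\mathbf F}=v_i$ and $q_n^{\mathbf F}(a,b_1,\dots,b_n)=s(a)$, where $s$ is the endomorphism of $\mathbf F_{\mathcal V}$ with $s(v_i)=b_i$ ($i\le n$) and $s(v_i)=v_i$ ($i>n$). A clone $\tau$-algebra is an algebra $(C,\sigma\ (\sigma\in\tau),q_n,\mathsf e_i)$, $q_n$ of arity $n+1$, $\mathsf e_i$ constants, satisfying: (C1) $q_n(\mathsf e_i,x_1,\dots,x_n)=x_i$ ($1\le i\le n$); (C2) $q_n(\mathsf e_j,x_1,\dots,x_n)=\mathsf e_j$ ($j>n$); (C3) $q_n(x,\mathsf e_1,\dots,\mathsf e_n)=x$; (C4) $q_k(x,y_1,\dots,y_k)=q_n(x,y_1,\dots,y_k,\mathsf e_{k+1},\dots,\mathsf e_n)$ ($n>k$); (C5) $q_n(q_n(x,\mathbf y),\mathbf z)=q_n(x,q_n(y_1,\mathbf z),\dots,q_n(y_n,\mathbf z))$; (C6) $q_n(\sigma(x_1,\dots,x_k),\mathbf y)=\sigma(q_n(x_1,\mathbf y),\dots,q_n(x_k,\mathbf y))$. An element $a$ is independent of $\mathsf e_n$ if $q_n(a,\mathsf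 e_1,\dots,\mathsf e_{n-1},\mathsf e_{n+1})=a$; its dimension is $\omega$ if it depends on infinitely many $\mathsf e_i$, $0$ if on none, else the largest such $i$; finite dimensional means all elements have finite dimension. $\mathrm{Clo}\,\mathbf F_{\mathcal V}$ is the clone of all term operations (of all finite arities, including nullary restrictions) of $\mathbf F_{\mathcal V}$. For an $n$-ary operation $f$ on a set $A$, $f^\top:A^\omega\to A$, $f^\top(s)=f(s_1,\dots,s_n)$. The full functional clone $\tau$-algebra with value domain a $\tau$-algebra $\mathbf A$ has universe all maps $A^\omega\to A$, with $\mathsf e_i(s)=s_i$, $q_n(\varphi,\psi_1,\dots,\psi_n)(s)=\varphi(s[\psi_1(s),\dots,\psi_n(s)])$ ($s[a_1,\dots,a_n]$ replaces the first $n$ entries of $s$), $\sigma(\psi_1,\dots,\psi_k)(s)=\sigma^{\mathbf A}(\psi_1(s),\dots,\psi_k(s))$. -}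

module Defs where

-- Conventions: everything is 0-based.
--   variable v_{i+1} of the paper  = var i
--   constant e_{i+1} of the paper  = e i
--   q_n takes its n arguments as a vector Fin n → C (position i = paper's (i+1)-st argument)

open import Level using (Level; _⊔_; 0ℓ) renaming (suc to lsuc)
open import Data.Nat using (ℕ; zero; suc; _<_; _≤_; _∸_; _<?_)
open import Data.Fin using (Fin; toℕ; fromℕ<)
open import Data.Product using (Σ; ∃; ∃-syntax; _×_; _,_)
open import Data.Sum using (_⊎_)
open import Relation.Nullary using (¬_; yes; no)
open import Relation.Binary.PropositionalEquality using (_≡_)
open import Relation.Binary using (Setoid; IsEquivalence)

record Signature : Set₁ where
  field
    Op    : Set
    arity : Op → ℕ
open Signature public

data Term (τ : Signature) : Set where
  var : ℕ → Term τ
  op  : (f : Op τ) → (Fin (arity τ f) → Term τ) → Term τ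

Eqns : Signature → Set₁
Eqns τ = Term τ → Term τ → Set

module _ {τ : Signature} where

  _[_] : Term τ → (ℕ → Term τ) → Term τ
  var i [ s ] = s i
  op f ts [ s ] = op f (λ j → ts j [ s ])

  VarsBelow : ℕ → Term τ → Set
  VarsBelow n (var i) = i < n
  VarsBelow n (op f ts) = ∀ j → VarsBelow n (ts j)

  v₁↦v₂ : ℕ → Term τ
  v₁↦v₂ zero = var 1
  v₁↦v₂ (suc i) = var (suc i)

record Algebra (τ : Signature) : Set₁ where
  field
    S : Setoid 0ℓ 0ℓ
  open Setoid S public
  field
    ⟦_⟧ : (f : Op τ) → (Fin (arity τ f) → Carrier) → Carrier
    ⟦⟧-cong : ∀ f {xs ys : Fin (arity τ f) → Carrier} →
              (∀ j → xs j ≈ ys j) → ⟦ f ⟧ xs ≈ ⟦ f ⟧ ys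

module _ {τ : Signature} where

  eval : (A : Algebra τ) → (ℕ → Algebra.Carrier A) → Term τ → Algebra.Carrier A
  eval A ρ (var i) = ρ i
  eval A ρ (op f ts) = Algebra.⟦_⟧ A f (λ j → eval A ρ (ts j))

  _⊨_≐_ : Algebra τ → Term τ → Term τ → Set
  A ⊨ s ≐ t = ∀ ρ → Algebra._≈_ A (eval A ρ s) (eval A ρ t)

  Models : Algebra τ → Eqns τ → Set
  Models A E = ∀ s t → E s t → A ⊨ s ≐ t

  Mod_⊨_≐_ : Eqns τ → Term τ → Term τ → Set₁
  Mod E ⊨ s ≐ t = ∀ (A : Algebra τ) → Models A E → A ⊨ s ≐ t

  IsEqTheory : Eqns τ → Set₁
  IsEqTheory E = ∀ s t → Mod E ⊨ s ≐ t → E s t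

pad : ∀ {c} {C : Set c} (k n : ℕ) → (Fin k → C) → (ℕ → C) → Fin n → C
pad k n y g i with toℕ i <? k
... | yes p = y (fromℕ< p)
... | no _ = g (toℕ i)

module _ {τ : Signature} {c ℓ : Level} {C : Set c} (_≈_ : C → C → Set ℓ)
         (σ : (f : Op τ) → (Fin (arity τ f) → C) → C)
         (q : (n : ℕ) → C → (Fin n → C) → C)
         (e : ℕ → C) where

  record IsCloneAlgebra : Set (c ⊔ ℓ) where
    field
      isEquivalence : IsEquivalence _≈_
      σ-cong : ∀ f {xs ys} → (∀ j → xs j ≈ ys j) → σ f xs ≈ σ f ys
      q-cong : ∀ n {x x' y y'} → x ≈ x' → (∀ i → y i ≈ y' i) → q n x y ≈ q n x' y'
      C1 : ∀ n (i : Fin n) x → q n (e (toℕ i)) x ≈ x i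
      C2 : ∀ n j x → n ≤ j → q n (e j) x ≈ e j
      C3 : ∀ n x → q n x (λ i → e (toℕ i)) ≈ x
      C4 : ∀ k n x y → k < n → q k x y ≈ q n x (pad k n y e)
      C5 : ∀ n x y z → q n (q n x y) z ≈ q n x (λ i → q n (y i) z)
      C6 : ∀ n f xs y → q n (σ f xs) y ≈ σ f (λ j → q n (xs j) y)

  -- a is independent of e_{m+1}:  q_{m+1}(a, e_1..e_m, e_{m+2}) = a
  Indep : C → ℕ → Set ℓ
  Indep a m = q (suc m) a (pad m (suc m) (λ i → e (toℕ i)) (λ _ → e (suc m))) ≈ a

  HasDim : C → ℕ → Set ℓ
  HasDim a n = (∀ m → n ≤ m → Indep a m) × (n ≡ 0 ⊎ ¬ Indep a (n ∸ 1))

  FiniteDimensional : Set (c ⊔ ℓ)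
  FiniteDimensional = ∀ a → ∃[ n ] (∀ m → n ≤ m → Indep a m)

-- The clone V-algebra Cl(V), V = Mod(T): universe F_V = terms modulo ≈V

module _ {τ : Signature} where

  _≈V[_]_ : Term τ → Eqns τ → Term τ → Set₁
  s ≈V[ T ] t = Mod T ⊨ s ≐ t

  upd : (n : ℕ) → (Fin n → Term τ) → ℕ → Term τ
  upd n b i with i <? n
  ... | yes p = b (fromℕ< p)
  ... | no _ = var i

  qF : (n : ℕ) → Term τ → (Fin n → Term τ) → Term τ
  qF n a b = a [ upd n b ]

  eF : ℕ → Term τ
  eF = var

  record Congruence (T : Eqns τ) : Set₁ where
    field
      θ : Term τ → Term τ → Set
      isEquivalence : IsEquivalence θ
      ⊇≈V : ∀ {s t} → s ≈V[ T ] t → θ s t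
      op-compat : ∀ f {xs ys} → (∀ j → θ (xs j) (ys j)) → θ (op f xs) (op f ys)
      q-compat : ∀ n {a a' b b'} → θ a a' → (∀ i → θ (b i) (b' i)) →
                 θ (qF n a b) (qF n a' b')
      -- (compatibility with the constants e_i is automatic)

  record ExtTheory (T : Eqns τ) : Set₁ where
    field
      E : Eqns τ
      isEqTheory : IsEqTheory E
      ⊇T : ∀ {s t} → T s t → E s t

  _⊆_ : Eqns τ → Eqns τ → Set
  R ⊆ R' = ∀ {s t} → R s t → R' s t

  record ConLatticeIso (T : Eqns τ) : Set₁ where
    field
      to   : Congruence T → ExtTheory T
      from : ExtTheory T → Congruence T
      to-mono   : ∀ θ θ' → Congruence.θ θ ⊆ Congruence.θ θ' →
                  ExtTheory.E (to θ) ⊆ ExtTheory.E (to θ')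
      from-mono : ∀ E E' → ExtTheory.E E ⊆ ExtTheory.E E' →
                  Congruence.θ (from E) ⊆ Congruence.θ (from E')
      from∘to   : ∀ θ → (Congruence.θ (from (to θ)) ⊆ Congruence.θ θ)
                        × (Congruence.θ θ ⊆ Congruence.θ (from (to θ)))
      to∘from   : ∀ E → (ExtTheory.E (to (from E)) ⊆ ExtTheory.E E)
                        × (ExtTheory.E E ⊆ ExtTheory.E (to (from E)))

  -- full functional clone τ-algebra with value domain F_V
  -- elements: maps F_V^ω → F_V, represented by (ℕ → Term τ) → Term τ
  -- respecting ≈V pointwise; equality: pointwise ≈V

  Fun : Set
  Fun = (ℕ → Term τ) → Term τ

  RespectsV : Eqns τ → Fun → Set₁
  RespectsV T φ = ∀ {s s'} → (∀ i → s i ≈V[ T ] s' i) → φ s ≈V[ T ] φ s'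

  _≗V[_]_ : Fun → Eqns τ → Fun → Set₁
  φ ≗V[ T ] ψ = ∀ s → φ s ≈V[ T ] ψ s

  eFun : ℕ → Fun
  eFun i s = s i

  _⟪_⟫ : {n : ℕ} → (ℕ → Term τ) → (Fin n → Term τ) → ℕ → Term τ
  _⟪_⟫ {n} s a i with i <? n
  ... | yes p = a (fromℕ< p)
  ... | no _ = s i

  qFun : (n : ℕ) → Fun → (Fin n → Fun) → Fun
  qFun n φ ψ s = φ (s ⟪ (λ i → ψ i s) ⟫)

  σFun : (f : Op τ) → (Fin (arity τ f) → Fun) → Fun
  σFun f ψ s = op f (λ j → ψ j s)

  -- φ = f^⊤ for some f ∈ Clo F_V: f is the n-ary term operation of F_V
  -- induced by a term t in the variables v_1..v_n, i.e. f(a_1..a_n) = t[a_1..a_n]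
  IsTermOp⊤ : Eqns τ → Fun → Set₁
  IsTermOp⊤ T φ = ∃[ n ] ∃[ t ] (VarsBelow n t × (∀ s → φ s ≈V[ T ] (t [ s ])))

  record FunctionalIso (T : Eqns τ) : Set₁ where
    field
      h        : Term τ → Fun
      h-resp   : ∀ w → RespectsV T (h w)
      h-image  : ∀ w → IsTermOp⊤ T (h w)
      h-cong   : ∀ w w' → w ≈V[ T ] w' → h w ≗V[ T ] h w'
      h-inj    : ∀ w w' → h w ≗V[ T ] h w' → w ≈V[ T ] w'
      h-surj   : ∀ φ → RespectsV T φ → IsTermOp⊤ T φ → ∃[ w ] (h w ≗V[ T ] φ)
      h-op     : ∀ f ws → h (op f ws) ≗V[ T ] σFun f (λ j → h (ws j))
      h-q      : ∀ n a b → h (qF n a b) ≗V[ T ] qFun n (h a) (λ i → h (b i))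
      h-e      : ∀ i → h (eF i) ≗V[ T ] eFun i

-- Everything reduces to three facts about V-equality ≈V of terms: it is a
-- congruence for the operations, it is invariant under substitution, and
-- substitution is associative up to ≈V.  With q_n read as substitution, the
-- clone axioms become pointwise identities between substitutions, and the
-- congruences of Cl(V) are exactly the equational theories containing T
-- (closure under q_n gives closure under substitution, and a relation
-- closed under substitution is complete for its own term model).  For the
-- dimension statements, a term independent of every e_m with m ≥ n is shown
-- to depend only on v_1, …, v_n by descending from a syntactic bound on its
-- variables, one independence step at a time.
{-# OPTIONS --safe #-}
module Submission where

open import Defs
open import Data.Nat using (ℕ; _<_)
open import Data.Product using (_×_; ∃-syntax)

open import Level using (0ℓ) renaming (suc to lsuc)
open import Function using (_∘_)
open import Data.Nat using (zero; suc; _+_; _⊔_; _≤_; _<?_; z≤n; s≤s)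
open import Data.Nat.Properties
  using (≤-refl; ≤-trans; <-≤-trans; <-trans; ≤⇒≯; <-irrefl; n<1+n; m≤m+n; m≤n+m; m≤m⊔n; m≤n⊔m; m<1+n⇒m<n∨m≡n)
open import Data.Fin as Fin using (Fin; toℕ; fromℕ<)
open import Data.Fin.Properties using (toℕ-fromℕ<; fromℕ<-toℕ; fromℕ<-cong; toℕ<n)
open import Data.Product using (_,_)
open import Data.Sum using (inj₁; inj₂)
open import Data.Empty using (⊥-elim)
open import Relation.Nullary using (¬_; Dec; yes; no)
open import Relation.Binary using (Setoid; IsEquivalence)
open import Relation.Binary.PropositionalEquality as ≡ using (_≡_)
import Relation.Binary.Reasoning.Setoid as SetoidReasoning

module _ {τ : Signature} where

  VarsBelow-mono : ∀ {m n} → m ≤ n → (t : Term τ) → VarsBelow m t → VarsBelow n t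
  VarsBelow-mono m≤n (var i) i<m = <-≤-trans i<m m≤n
  VarsBelow-mono m≤n (op f ts) vb = λ j → VarsBelow-mono m≤n (ts j) (vb j)

  VarsBelow-[] : ∀ n (t : Term τ) σ → (∀ i → VarsBelow n (σ i)) → VarsBelow n (t [ σ ])
  VarsBelow-[] n (var i) σ vb = vb i
  VarsBelow-[] n (op f ts) σ vb = λ j → VarsBelow-[] n (ts j) σ vb

  ⨆ : ∀ {k} → (Fin k → ℕ) → ℕ
  ⨆ {zero} f = 0
  ⨆ {suc k} f = f Fin.zero ⊔ ⨆ (f ∘ Fin.suc)

  ≤-⨆ : ∀ {k} (f : Fin k → ℕ) j → f j ≤ ⨆ f
  ≤-⨆ f Fin.zero = m≤m⊔n _ _
  ≤-⨆ f (Fin.suc j) = ≤-trans (≤-⨆ (f ∘ Fin.suc) j) (m≤n⊔m _ _)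

  varBound : Term τ → ℕ
  varBound (var i) = suc i
  varBound (op f ts) = ⨆ (λ j → varBound (ts j))

  VarsBelow-varBound : ∀ t → VarsBelow (varBound t) t
  VarsBelow-varBound (var i) = ≤-refl
  VarsBelow-varBound (op f ts) = λ j →
    VarsBelow-mono (≤-⨆ (λ j → varBound (ts j)) j) (ts j) (VarsBelow-varBound (ts j))

  upd-< : ∀ {n} (b : Fin n → Term τ) {i} (i<n : i < n) → upd n b i ≡ b (fromℕ< i<n)
  upd-< {n} b {i} i<n with i <? n
  ... | yes _ = ≡.refl
  ... | no i≮n = ⊥-elim (i≮n i<n)

  upd-≮ : ∀ {n} (b : Fin n → Term τ) {i} → ¬ i < n → upd n b i ≡ var i
  upd-≮ {n} b {i} i≮n with i <? n
  ... | yes i<n = ⊥-elim (i≮n i<n)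
  ... | no _ = ≡.refl

  upd-cong : ∀ {ℓ} (R : Term τ → Term τ → Set ℓ) → (∀ {t} → R t t) →
             ∀ n {b b'} → (∀ k → R (b k) (b' k)) → ∀ i → R (upd n b i) (upd n b' i)
  upd-cong R R-refl n b≈b' i with i <? n
  ... | yes i<n = b≈b' (fromℕ< i<n)
  ... | no _ = R-refl

  upd-toℕ : ∀ {n} (b : Fin n → Term τ) (i : Fin n) → upd n b (toℕ i) ≡ b i
  upd-toℕ b i = ≡.trans (upd-< b (toℕ<n i)) (≡.cong b (fromℕ<-toℕ i (toℕ<n i)))

  upd-var : ∀ n i → upd n (λ (j : Fin n) → var {τ} (toℕ j)) i ≡ var i
  upd-var n i with i <? n
  ... | yes i<n = ≡.cong var (toℕ-fromℕ< i<n)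
  ... | no _ = ≡.refl

  pad-< : ∀ {k n} (y : Fin k → Term τ) g (i : Fin n) (p : toℕ i < k) → pad k n y g i ≡ y (fromℕ< p)
  pad-< {k} y g i p with toℕ i <? k
  ... | yes _ = ≡.refl
  ... | no ¬p = ⊥-elim (¬p p)

  pad-≮ : ∀ {k n} (y : Fin k → Term τ) g (i : Fin n) → ¬ toℕ i < k → pad k n y g i ≡ g (toℕ i)
  pad-≮ {k} y g i ¬p with toℕ i <? k
  ... | yes p = ⊥-elim (¬p p)
  ... | no _ = ≡.refl

  upd-pad-< : ∀ {k n} (y : Fin k → Term τ) g {i} (i<k : i < k) (i<n : i < n) →
              upd n (pad k n y g) i ≡ y (fromℕ< i<k)
  upd-pad-< {k} y g {i} i<k i<n = ≡.trans (upd-< (pad k _ y g) i<n)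
    (≡.trans (pad-< y g (fromℕ< i<n) i'<k)
      (≡.cong y (fromℕ<-cong _ _ (toℕ-fromℕ< i<n) i'<k i<k)))
    where
    i'<k : toℕ (fromℕ< i<n) < k
    i'<k = ≡.subst (_< k) (≡.sym (toℕ-fromℕ< i<n)) i<k

  upd-pad-≮ : ∀ {k n} (y : Fin k → Term τ) g {i} → ¬ i < k → (i<n : i < n) →
              upd n (pad k n y g) i ≡ g i
  upd-pad-≮ {k} y g {i} i≮k i<n = ≡.trans (upd-< (pad k _ y g) i<n)
    (≡.trans (pad-≮ y g (fromℕ< i<n) (i≮k ∘ ≡.subst (_< k) (toℕ-fromℕ< i<n)))
      (≡.cong g (toℕ-fromℕ< i<n)))

  upd-pad-var : ∀ {k n} (y : Fin k → Term τ) → k < n → ∀ i → upd k y i ≡ upd n (pad k n y var) i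
  upd-pad-var {k} {n} y k<n i with i <? k
  ... | yes i<k = ≡.sym (upd-pad-< y var i<k (<-trans i<k k<n))
  ... | no i≮k = ≡.sym (beyond-k (i <? n))
    where
    beyond-k : Dec (i < n) → upd n (pad k n y var) i ≡ var i
    beyond-k (yes i<n) = upd-pad-≮ y var i≮k i<n
    beyond-k (no i≮n) = upd-≮ _ i≮n

  -- The substitution in the definition of Indep w k: v_{k+1} ↦ v_{k+2}.
  renameVar : ℕ → ℕ → Term τ
  renameVar k = upd (suc k) (pad k (suc k) (λ i → var (toℕ i)) (λ _ → var (suc k)))

  renameVar-< : ∀ {k i} → i < k → renameVar k i ≡ var i
  renameVar-< {k} i<k = ≡.trans (upd-pad-< _ _ i<k (<-trans i<k (n<1+n k))) (≡.cong var (toℕ-fromℕ< i<k))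

  renameVar-self : ∀ k → renameVar k k ≡ var (suc k)
  renameVar-self k = upd-pad-≮ _ _ (<-irrefl ≡.refl) (n<1+n k)

  module _ (A : Algebra τ) where
    open Algebra A

    eval-cong-below : ∀ {n ρ ρ'} t → VarsBelow n t → (∀ i → i < n → ρ i ≈ ρ' i) →
                      eval A ρ t ≈ eval A ρ' t
    eval-cong-below (var i) i<n ρ≈ρ' = ρ≈ρ' i i<n
    eval-cong-below (op f ts) vb ρ≈ρ' = ⟦⟧-cong f (λ j → eval-cong-below (ts j) (vb j) ρ≈ρ')

    eval-cong : ∀ {ρ ρ'} t → (∀ i → ρ i ≈ ρ' i) → eval A ρ t ≈ eval A ρ' t
    eval-cong t ρ≈ρ' = eval-cong-below t (VarsBelow-varBound t) (λ i _ → ρ≈ρ' i)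

    eval-[] : ∀ ρ σ t → eval A ρ (t [ σ ]) ≈ eval A (λ i → eval A ρ (σ i)) t
    eval-[] ρ σ (var i) = refl
    eval-[] ρ σ (op f ts) = ⟦⟧-cong f (λ j → eval-[] ρ σ (ts j))

  -- ≈V[ T ] unfolds to a statement about evaluations, from which Agda cannot
  -- recover the two terms; this wrapper keeps them visible to unification.
  infix 4 _≈[_]_
  record _≈[_]_ (s : Term τ) (T : Eqns τ) (t : Term τ) : Set₁ where
    constructor fromV
    field toV : s ≈V[ T ] t
  open _≈[_]_ public

  module _ {T : Eqns τ} where

    ≈-isEquivalence : IsEquivalence (_≈[ T ]_)
    ≈-isEquivalence = record
      { refl = fromV λ A _ _ → Algebra.refl A
      ; sym = λ s≈t → fromV λ A M ρ → Algebra.sym A (toV s≈t A M ρ)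
      ; trans = λ s≈t t≈u → fromV λ A M ρ → Algebra.trans A (toV s≈t A M ρ) (toV t≈u A M ρ)
      }

    ≈-setoid : Setoid 0ℓ (lsuc 0ℓ)
    ≈-setoid = record { isEquivalence = ≈-isEquivalence }

    open Setoid ≈-setoid public
      using () renaming (refl to ≈-refl; sym to ≈-sym; trans to ≈-trans; reflexive to ≡⇒≈)

    op-cong : ∀ f {xs ys} → (∀ j → xs j ≈[ T ] ys j) → op f xs ≈[ T ] op f ys
    op-cong f xs≈ys = fromV λ A M ρ → Algebra.⟦⟧-cong A f (λ j → toV (xs≈ys j) A M ρ)

    []-cong-below : ∀ {n σ σ'} t → VarsBelow n t → (∀ i → i < n → σ i ≈[ T ] σ' i) →
                    t [ σ ] ≈[ T ] t [ σ' ]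
    []-cong-below {σ = σ} {σ'} t vb σ≈σ' = fromV λ A M ρ →
      let open Algebra A in
      trans (eval-[] A ρ σ t)
        (trans (eval-cong-below A t vb (λ i i<n → toV (σ≈σ' i i<n) A M ρ))
          (sym (eval-[] A ρ σ' t)))

    []-cong : ∀ {σ σ'} t → (∀ i → σ i ≈[ T ] σ' i) → t [ σ ] ≈[ T ] t [ σ' ]
    []-cong t σ≈σ' = []-cong-below t (VarsBelow-varBound t) (λ i _ → σ≈σ' i)

    ≈-[] : ∀ σ {s t} → s ≈[ T ] t → s [ σ ] ≈[ T ] t [ σ ]
    ≈-[] σ {s} {t} s≈t = fromV λ A M ρ →
      let open Algebra A in
      trans (eval-[] A ρ σ s) (trans (toV s≈t A M _) (sym (eval-[] A ρ σ t)))

    []-assoc : ∀ t σ σ' → (t [ σ ]) [ σ' ] ≈[ T ] t [ (λ i → σ i [ σ' ]) ]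
    []-assoc t σ σ' = fromV λ A M ρ →
      let open Algebra A in
      trans (eval-[] A ρ σ' (t [ σ ]))
        (trans (eval-[] A _ σ t)
          (trans (eval-cong A t (λ i → sym (eval-[] A ρ σ' (σ i))))
            (sym (eval-[] A ρ _ t))))

    []-var : ∀ t → t [ var ] ≈[ T ] t
    []-var t = fromV λ A M ρ → eval-[] A ρ var t

    qF-cong : ∀ n {a a' b b'} → a ≈[ T ] a' → (∀ i → b i ≈[ T ] b' i) →
              qF n a b ≈[ T ] qF n a' b'
    qF-cong n {a' = a'} {b} a≈a' b≈b' =
      ≈-trans (≈-[] (upd n b) a≈a') ([]-cong a' (upd-cong _≈[ T ]_ ≈-refl n b≈b'))

    upd-[] : ∀ n (y z : Fin n → Term τ) i →
             upd n y i [ upd n z ] ≈[ T ] upd n (λ k → y k [ upd n z ]) i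
    upd-[] n y z i with i <? n
    ... | yes _ = ≈-refl
    ... | no i≮n = ≡⇒≈ (upd-≮ z i≮n)

    qF-assoc : ∀ n x y z → qF n (qF n x y) z ≈[ T ] qF n x (λ i → qF n (y i) z)
    qF-assoc n x y z = ≈-trans ([]-assoc x (upd n y) (upd n z)) ([]-cong x (upd-[] n y z))

  module ≈-Reasoning (T : Eqns τ) = SetoidReasoning (≈-setoid {T})

  Cl-isCloneAlgebra : ∀ T → IsCloneAlgebra (λ s t → s ≈V[ T ] t) op qF eF
  Cl-isCloneAlgebra T = record
    { isEquivalence = record
        { refl = λ {s} → toV (≈-refl {x = s})
        ; sym = λ {s} {t} s≈t → toV (≈-sym (fromV {s} {T} {t} s≈t))
        ; trans = λ {s} {t} {u} s≈t t≈u → toV (≈-trans (fromV {s} {T} {t} s≈t) (fromV {t} {T} {u} t≈u))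
        }
    ; σ-cong = λ f {xs} {ys} xs≈ys → toV (op-cong f (λ j → fromV {xs j} {T} {ys j} (xs≈ys j)))
    ; q-cong = λ n {x} {x'} {y} {y'} x≈x' y≈y' →
        toV (qF-cong n (fromV {x} {T} {x'} x≈x') (λ i → fromV {y i} {T} {y' i} (y≈y' i)))
    ; C1 = λ n i x → toV (≡⇒≈ (upd-toℕ x i))
    ; C2 = λ n j x n≤j → toV (≡⇒≈ (upd-≮ x (≤⇒≯ n≤j)))
    ; C3 = λ n x → toV (≈-trans ([]-cong x (≡⇒≈ ∘ upd-var n)) ([]-var x))
    ; C4 = λ k n x y k<n → toV ([]-cong x (≡⇒≈ ∘ upd-pad-var y k<n))
    ; C5 = λ n x y z → toV (qF-assoc n x y z)
    ; C6 = λ n f xs y → toV (≈-refl {x = op f (λ j → qF n (xs j) y)})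
    }

  DependsOnlyOnFirst : Eqns τ → ℕ → Term τ → Set₁
  DependsOnlyOnFirst T n w =
    ∀ σ σ' → (∀ i → i < n → σ i ≈[ T ] σ' i) → w [ σ ] ≈[ T ] w [ σ' ]

  module _ {T : Eqns τ} where

    VarsBelow⇒DependsOnlyOnFirst : ∀ {n} w → VarsBelow n w → DependsOnlyOnFirst T n w
    VarsBelow⇒DependsOnlyOnFirst w vb σ σ' = []-cong-below w vb

    DependsOnlyOnFirst-fixes : ∀ {n} w {σ} → DependsOnlyOnFirst T n w →
                               (∀ i → i < n → σ i ≈[ T ] var i) → w [ σ ] ≈[ T ] w
    DependsOnlyOnFirst-fixes w {σ} dep σ≈var = ≈-trans (dep σ var σ≈var) ([]-var w)

    -- Replace σ by μ, which agrees with σ up to v_{k+1} and puts σ' k at v_{k+2};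
    -- renaming v_{k+1} to v_{k+2} then turns μ into a substitution agreeing with σ' up to v_{k+1}.
    DependsOnlyOnFirst-pred : ∀ k w → w [ renameVar k ] ≈[ T ] w →
                              DependsOnlyOnFirst T (suc k) w → DependsOnlyOnFirst T k w
    DependsOnlyOnFirst-pred k w indep dep σ σ' σ≈σ' = begin
      w [ σ ]                            ≈⟨ dep σ μ (λ i i<1+k → ≡⇒≈ (≡.sym (μ-≤ i<1+k))) ⟩
      w [ μ ]                            ≈⟨ ≈-[] μ indep ⟨
      (w [ renameVar k ]) [ μ ]          ≈⟨ []-assoc w (renameVar k) μ ⟩
      w [ (λ i → renameVar k i [ μ ]) ]  ≈⟨ dep _ σ' renamed≈σ' ⟩
      w [ σ' ]                           ∎
      where
      open ≈-Reasoning T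

      μ : ℕ → Term τ
      μ i with i <? suc k
      ... | yes _ = σ i
      ... | no _ = σ' k

      μ-≤ : ∀ {i} → i < suc k → μ i ≡ σ i
      μ-≤ {i} i<1+k with i <? suc k
      ... | yes _ = ≡.refl
      ... | no i≮1+k = ⊥-elim (i≮1+k i<1+k)

      μ-next : μ (suc k) ≡ σ' k
      μ-next with suc k <? suc k
      ... | yes k<k = ⊥-elim (<-irrefl ≡.refl k<k)
      ... | no _ = ≡.refl

      renamed≈σ' : ∀ i → i < suc k → renameVar k i [ μ ] ≈[ T ] σ' i
      renamed≈σ' i i<1+k with m<1+n⇒m<n∨m≡n i<1+k
      ... | inj₁ i<k = ≈-trans (≡⇒≈ (≡.trans (≡.cong (_[ μ ]) (renameVar-< i<k)) (μ-≤ i<1+k)))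
                               (σ≈σ' i i<k)
      ... | inj₂ ≡.refl = ≡⇒≈ (≡.trans (≡.cong (_[ μ ]) (renameVar-self i)) μ-next)

    independentAbove⇒DependsOnlyOnFirst :
      ∀ n w → (∀ m → n ≤ m → Indep (λ s t → s ≈V[ T ] t) op qF eF w m) → DependsOnlyOnFirst T n w
    independentAbove⇒DependsOnlyOnFirst n w indep = descend (varBound w)
      (VarsBelow⇒DependsOnlyOnFirst w (VarsBelow-mono (m≤m+n (varBound w) n) w (VarsBelow-varBound w)))
      where
      descend : ∀ d → DependsOnlyOnFirst T (d + n) w → DependsOnlyOnFirst T n w
      descend zero dep = dep
      descend (suc d) dep =
        descend d (DependsOnlyOnFirst-pred (d + n) w (fromV (indep (d + n) (m≤n+m n d))) dep)

  Cl-finiteDimensional : ∀ T → FiniteDimensional (λ s t → s ≈V[ T ] t) op qF eF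
  Cl-finiteDimensional T a = varBound a , λ m bound≤m →
    toV (DependsOnlyOnFirst-fixes a (VarsBelow⇒DependsOnlyOnFirst a (VarsBelow-varBound a))
      (λ i i<bound → ≡⇒≈ (renameVar-< (<-≤-trans i<bound bound≤m))))

  dimension-suc⇒term : ∀ T (w : Term τ) n → 0 < n → HasDim (λ s t → s ≈V[ T ] t) op qF eF w n →
                       ∃[ t ] (VarsBelow n t × t ≈V[ T ] w)
  dimension-suc⇒term T w n 0<n (indep , _) =
    w [ clamp ] , VarsBelow-[] n w clamp clamp-below ,
    toV (DependsOnlyOnFirst-fixes w (independentAbove⇒DependsOnlyOnFirst n w indep)
                                    (λ i i<n → ≡⇒≈ (clamp-< i<n)))
    where
    clamp : ℕ → Term τ
    clamp i with i <? n
    ... | yes _ = var i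
    ... | no _ = var 0

    clamp-below : ∀ i → VarsBelow n (clamp i)
    clamp-below i with i <? n
    ... | yes i<n = i<n
    ... | no _ = 0<n

    clamp-< : ∀ {i} → i < n → clamp i ≡ var i
    clamp-< {i} i<n with i <? n
    ... | yes _ = ≡.refl
    ... | no i≮n = ⊥-elim (i≮n i<n)

  dimension-zero⇒term : ∀ T (w : Term τ) → HasDim (λ s t → s ≈V[ T ] t) op qF eF w 0 →
                        ∃[ t ] (VarsBelow 1 t × t ≈V[ T ] w × t ≈V[ T ] (t [ v₁↦v₂ ]))
  dimension-zero⇒term T w (indep , _) =
    w [ (λ _ → var 0) ] , VarsBelow-[] 1 w _ (λ _ → s≤s z≤n) ,
    toV (constant-fixed 0) , toV t≈t[v₁↦v₂]
    where
    open ≈-Reasoning T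

    constant-fixed : ∀ k → w [ (λ _ → var k) ] ≈[ T ] w
    constant-fixed k = DependsOnlyOnFirst-fixes w
      (independentAbove⇒DependsOnlyOnFirst 0 w indep) (λ _ ())

    t≈t[v₁↦v₂] : w [ (λ _ → var 0) ] ≈[ T ] (w [ (λ _ → var 0) ]) [ v₁↦v₂ ]
    t≈t[v₁↦v₂] = begin
      w [ (λ _ → var 0) ]                  ≈⟨ constant-fixed 0 ⟩
      w                                    ≈⟨ constant-fixed 1 ⟨
      w [ (λ _ → var 1) ]                  ≈⟨ []-assoc w (λ _ → var 0) v₁↦v₂ ⟨
      (w [ (λ _ → var 0) ]) [ v₁↦v₂ ]      ∎

  module TermModel (θ : Eqns τ) (θ-isEquivalence : IsEquivalence θ)
                   (θ-op : ∀ f {xs ys} → (∀ j → θ (xs j) (ys j)) → θ (op f xs) (op f ys)) where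
    open IsEquivalence θ-isEquivalence

    termAlgebra : Algebra τ
    termAlgebra = record
      { S = record { Carrier = Term τ ; _≈_ = θ ; isEquivalence = θ-isEquivalence }
      ; ⟦_⟧ = op
      ; ⟦⟧-cong = θ-op
      }

    eval-termAlgebra : ∀ ρ t → θ (eval termAlgebra ρ t) (t [ ρ ])
    eval-termAlgebra ρ (var i) = refl
    eval-termAlgebra ρ (op f ts) = θ-op f (λ j → eval-termAlgebra ρ (ts j))

    eval-termAlgebra-var : ∀ t → θ (eval termAlgebra var t) t
    eval-termAlgebra-var (var i) = refl
    eval-termAlgebra-var (op f ts) = θ-op f (λ j → eval-termAlgebra-var (ts j))

    []-closed⇒IsEqTheory : (∀ ρ {s t} → θ s t → θ (s [ ρ ]) (t [ ρ ])) → IsEqTheory θ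
    []-closed⇒IsEqTheory θ-[] s t ⊨s≐t =
      trans (sym (eval-termAlgebra-var s))
        (trans (⊨s≐t termAlgebra models var) (eval-termAlgebra-var t))
      where
      models : Models termAlgebra θ
      models s t s≈t ρ = trans (eval-termAlgebra ρ s)
        (trans (θ-[] ρ s≈t) (sym (eval-termAlgebra ρ t)))

  module _ {T : Eqns τ} where

    Congruence⇒ExtTheory : Congruence T → ExtTheory T
    Congruence⇒ExtTheory c = record
      { E = θ
      ; isEqTheory = TermModel.[]-closed⇒IsEqTheory θ isEquivalence op-compat θ-[]
      ; ⊇T = λ {s} {t} s≐t → ⊇≈V (λ A M → M s t s≐t)
      }
      where
      open Congruence c
      open IsEquivalence isEquivalence

      -- q_n-compatibility with n beyond both variable bounds yields substitution invariance.
      θ-[] : ∀ ρ {s t} → θ s t → θ (s [ ρ ]) (t [ ρ ])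
      θ-[] ρ {s} {t} s≈t =
        trans (⊇≈V (toV (≈-sym (truncate s (m≤m⊔n _ _)))))
          (trans (q-compat n s≈t (λ _ → refl)) (⊇≈V (toV (truncate t (m≤n⊔m _ _)))))
        where
        n = varBound s ⊔ varBound t

        truncate : ∀ u → varBound u ≤ n → qF n u (ρ ∘ toℕ) ≈[ T ] u [ ρ ]
        truncate u bound≤n = []-cong-below u (VarsBelow-mono bound≤n u (VarsBelow-varBound u))
          (λ i i<n → ≡⇒≈ (≡.trans (upd-< (ρ ∘ toℕ) i<n) (≡.cong ρ (toℕ-fromℕ< i<n))))

    ExtTheory⇒Congruence : ExtTheory T → Congruence T
    ExtTheory⇒Congruence X = record
      { θ = E
      ; isEquivalence = record
          { refl = λ {s} → isEqTheory s s (toV (≈-refl {x = s}))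
          ; sym = λ {s} {t} s≈t → isEqTheory t s (toV (≈-sym (sound s≈t)))
          ; trans = λ {s} {t} {u} s≈t t≈u → isEqTheory s u (toV (≈-trans (sound s≈t) (sound t≈u)))
          }
      ; ⊇≈V = λ {s} {t} s≈t → isEqTheory s t (λ A M → s≈t A (λ s' t' → M s' t' ∘ ⊇T))
      ; op-compat = λ f xs≈ys → isEqTheory _ _ (toV (op-cong f (sound ∘ xs≈ys)))
      ; q-compat = λ n a≈a' b≈b' → isEqTheory _ _ (toV (qF-cong n (sound a≈a') (sound ∘ b≈b')))
      }
      where
      open ExtTheory X

      sound : ∀ {s t} → E s t → s ≈[ E ] t
      sound {s} {t} s≐t = fromV λ A M → M s t s≐t

  Cl-conLatticeIso : ∀ T → ConLatticeIso T
  Cl-conLatticeIso T = record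
    { to = Congruence⇒ExtTheory
    ; from = ExtTheory⇒Congruence
    ; to-mono = λ _ _ θ⊆θ' → θ⊆θ'
    ; from-mono = λ _ _ E⊆E' → E⊆E'
    ; from∘to = λ _ → (λ x → x) , (λ x → x)
    ; to∘from = λ _ → (λ x → x) , (λ x → x)
    }

  upd-[]-⟪⟫ : ∀ {T} n (b : Fin n → Term τ) s i →
              upd n b i [ s ] ≈[ T ] (s ⟪ (λ k → b k [ s ]) ⟫) i
  upd-[]-⟪⟫ n b s i with i <? n
  ... | yes _ = ≈-refl
  ... | no _ = ≈-refl

  Cl-functionalIso : ∀ T → FunctionalIso T
  Cl-functionalIso T = record
    { h = _[_]
    ; h-resp = λ w {s} {s'} s≈s' → toV ([]-cong w (λ i → fromV {s i} {T} {s' i} (s≈s' i)))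
    ; h-image = λ w → varBound w , w , VarsBelow-varBound w , λ s → toV (≈-refl {x = w [ s ]})
    ; h-cong = λ w w' w≈w' s → toV (≈-[] s (fromV {w} {T} {w'} w≈w'))
    ; h-inj = λ w w' w≈w' → toV (begin
        w            ≈⟨ []-var w ⟨
        w [ var ]    ≈⟨ fromV (w≈w' var) ⟩
        w' [ var ]   ≈⟨ []-var w' ⟩
        w'           ∎)
    ; h-surj = λ { φ _ (n , t , _ , φ≈t) → t , λ s → toV (≈-sym (fromV {φ s} {T} {t [ s ]} (φ≈t s))) }
    ; h-op = λ f ws s → toV (≈-refl {x = op f ws [ s ]})
    ; h-q = λ n a b s → toV (≈-trans ([]-assoc a (upd n b) s) ([]-cong a (upd-[]-⟪⟫ n b s)))
    ; h-e = λ i s → toV (≈-refl {x = s i})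
    }
    where open ≈-Reasoning T

mainTheorem14 : (τ : Signature) (T : Eqns τ) → IsEqTheory T →
    ( IsCloneAlgebra (λ s t → s ≈V[ T ] t) op qF eF
    × FiniteDimensional (λ s t → s ≈V[ T ] t) op qF eF )
    × ConLatticeIso T
    × (∀ (w : Term τ) (n : ℕ) → 0 < n → HasDim (λ s t → s ≈V[ T ] t) op qF eF w n →
    ∃[ t ] (VarsBelow n t × t ≈V[ T ] w))
    × (∀ (w : Term τ) → HasDim (λ s t → s ≈V[ T ] t) op qF eF w 0 →
    ∃[ t ] (VarsBelow 1 t × t ≈V[ T ] w × t ≈V[ T ] (t [ v₁↦v₂ ])))
    × FunctionalIso T
mainTheorem14 τ T _ =
  (Cl-isCloneAlgebra T , Cl-finiteDimensional T) ,
  Cl-conLatticeIso T ,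
  dimension-suc⇒term T ,
  dimension-zero⇒term T ,
  Cl-functionalIso T
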